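{- Let $n\ge 1$ and let $E({\cal OCT}_n)$ be the set of idempotent ($\alpha^2=\alpha$) order-preserving full contractions of $X_n=\{1,\dots,n\}$. For integers $1\le p\le k\le n$, the number of $\alpha\in E({\cal OCT}_n)$ with $h(\alpha)=p$ and $w^+(\alpha)=k$ equals $1$, and the number of $\alpha\in E({\cal OCT}_n)$ with $f(\alpha)=p$ and $w^+(\alpha)=k$ equals $1$.
   Context: Full transformations are maps $\alpha:X_n\to X_n$, written $x\mapsto x\alpha$, composed left to right. Order-preserving: $x\le y\Rightarrow x\alpha\le y\alpha$. Contraction: $|x\alpha-y\alpha|\le|x-y|$ for all $x,y$. $h(\alpha)=|\mathrm{Im}\,\alpha|$, $w^+(\alpha)=\max(\mathrm{Im}\,\alpha)$, $f(\alpha)=|\{x:x\alpha=x\}|$. -}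

module Defs where

open import Data.Nat using (ℕ; suc; _≤_; _⊔_; ∣_-_∣)
open import Data.Fin using (Fin; toℕ)
import Data.Fin as F
open import Data.Fin.Properties using (any?; _≟_)
open import Data.Fin.Subset using (Subset; ∣_∣)
open import Data.Vec using (tabulate)
open import Data.List using (foldr; map; allFin)
open import Data.Product using (Σ; _×_)
open import Relation.Nullary using (does)
open import Relation.Binary.PropositionalEquality using (_≡_)

-- X_n = {1,…,n} is represented by Fin n, with element i : Fin n standing for toℕ i + 1.
-- A full transformation of X_n, x ↦ xα, is a function Fin n → Fin n.
Transformation : ℕ → Set
Transformation n = Fin n → Fin n

OrderPreserving : ∀ {n} → Transformation n → Set
OrderPreserving {n} α = ∀ (x y : Fin n) → x F.≤ y → α x F.≤ α y

Contraction : ∀ {n} → Transformation n → Set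
Contraction {n} α = ∀ (x y : Fin n) → ∣ toℕ (α x) - toℕ (α y) ∣ ≤ ∣ toℕ x - toℕ y ∣

Idempotent : ∀ {n} → Transformation n → Set
Idempotent {n} α = ∀ (x : Fin n) → α (α x) ≡ α x

IsEOCT : ∀ {n} → Transformation n → Set
IsEOCT α = Idempotent α × OrderPreserving α × Contraction α

Im : ∀ {n} → Transformation n → Subset n
Im {n} α = tabulate (λ y → does (any? (λ x → α x ≟ y)))

h : ∀ {n} → Transformation n → ℕ
h α = ∣ Im α ∣

-- w⁺(α) = max(Im α), as an element of {1,…,n} (i.e. 1-indexed)
w⁺ : ∀ {n} → Transformation n → ℕ
w⁺ {n} α = foldr _⊔_ 0 (map (λ x → suc (toℕ (α x))) (allFin n))

fix : ∀ {n} → Transformation n → ℕ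
fix {n} α = ∣ tabulate (λ x → does (α x ≟ x)) ∣

ExactlyOne : ∀ {n} → (Transformation n → Set) → Set
ExactlyOne {n} P =
  Σ (Transformation n) λ α → P α × (∀ β → P β → ∀ (x : Fin n) → β x ≡ α x)

module Submission where

-- On X_n (here Fin n, with i standing for i + 1) every idempotent
-- order-preserving contraction α is a clamp  x ↦ max(L, min(x, K)),  where
-- L = 1α is the least and K = w⁺(α) − 1 the greatest point of the image:
-- below L and above K monotonicity and idempotence pin α to L resp. K, and
-- between them the contraction property towards the fixed points L and K
-- forces xα = x.  Conversely every clamp with L ≤ K < n lies in E(OCT_n); its
-- image and its fixed-point set are both the interval [L, K], so
-- h = f = K + 1 − L and w⁺ = K + 1.  Hence (h, w⁺) = (p, k), or
-- (f, w⁺) = (p, k), determines L = k − p and K = k − 1 uniquely.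

open import Defs
open import Data.Nat using (ℕ; zero; suc; pred; _≤_; _<_; _⊔_; _⊓_; _∸_; _+_; ∣_-_∣; z≤n; s≤s; _≤?_; _<?_)
open import Data.Nat.Properties
open import Data.Fin using (Fin; toℕ; fromℕ<) renaming (zero to fzero; suc to fsuc)
open import Data.Fin.Properties using (toℕ-injective; toℕ-fromℕ<; any?) renaming (_≟_ to _≟F_)
open import Data.Fin.Subset using (Subset; ∣_∣)
open import Data.Bool using (Bool; true; false)
open import Data.Vec using (_∷_; tabulate)
open import Data.Vec.Properties using (tabulate-cong)
open import Data.List using (List; map; allFin)
open import Data.List.Properties using (foldr-forcesᵇ; foldr-preservesᵇ)
open import Data.List.Membership.Propositional.Properties using (∈-allFin; ∈-map⁻; foldr-selective)
import Data.List.Relation.Unary.All as All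
open import Data.List.Relation.Unary.All.Properties using (map⁺; map⁻)
open import Data.Product using (∃; _×_; _,_; proj₁; proj₂)
open import Data.Product.Function.NonDependent.Propositional using (_×-⇔_)
open import Data.Sum using (inj₁; inj₂)
open import Function using (_∘_; _⇔_; mk⇔)
open import Relation.Nullary using (does; yes; no; contradiction)
open import Relation.Nullary.Decidable using (_×-dec_; does-⇔)
open import Relation.Binary.PropositionalEquality

clamp : ℕ → ℕ → ℕ → ℕ
clamp L K m = L ⊔ (m ⊓ K)

module _ (L K : ℕ) where

  clamp-mono : ∀ {m m′} → m ≤ m′ → clamp L K m ≤ clamp L K m′
  clamp-mono m≤m′ = ⊔-monoʳ-≤ L (⊓-monoˡ-≤ K m≤m′)

  clamp-range : L ≤ K → ∀ m → L ≤ clamp L K m × clamp L K m ≤ K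
  clamp-range L≤K m = m≤m⊔n L _ , ⊔-lub L≤K (m⊓n≤n m K)

  clamp-below : ∀ {m} → m ≤ L → clamp L K m ≡ L
  clamp-below {m} m≤L = m≥n⇒m⊔n≡m (≤-trans (m⊓n≤m m K) m≤L)

  clamp-above : ∀ {m} → L ≤ K → K ≤ m → clamp L K m ≡ K
  clamp-above L≤K K≤m = trans (cong (L ⊔_) (m≥n⇒m⊓n≡n K≤m)) (m≤n⇒m⊔n≡n L≤K)

  clamp-fixes : ∀ {m} → L ≤ m → m ≤ K → clamp L K m ≡ m
  clamp-fixes L≤m m≤K = trans (cong (L ⊔_) (m≤n⇒m⊓n≡m m≤K)) (m≤n⇒m⊔n≡n L≤m)

  clamp-idem : L ≤ K → ∀ m → clamp L K (clamp L K m) ≡ clamp L K m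
  clamp-idem L≤K m = clamp-fixes (proj₁ (clamp-range L≤K m)) (proj₂ (clamp-range L≤K m))

-- A map g on ℕ is non-expanding if it moves the endpoints of m ≤ m′ at most
-- m′ − m apart (measured upwards); for monotone maps this is the contraction law.
NonExpanding : (ℕ → ℕ) → Set
NonExpanding g = ∀ {m m′} → m ≤ m′ → g m′ ∸ g m ≤ m′ ∸ m

⊓-nonExpanding : ∀ K → NonExpanding (_⊓ K)
⊓-nonExpanding K {m} {m′} m≤m′ with ≤-total m K
... | inj₁ m≤K rewrite m≤n⇒m⊓n≡m m≤K = ∸-monoˡ-≤ m (m⊓n≤m m′ K)
... | inj₂ K≤m rewrite m≥n⇒m⊓n≡n K≤m | m≥n⇒m⊓n≡n (≤-trans K≤m m≤m′) | n∸n≡0 K = z≤n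

⊔-nonExpanding : ∀ L → NonExpanding (L ⊔_)
⊔-nonExpanding L {m} {m′} m≤m′ with ≤-total L m
... | inj₁ L≤m rewrite m≤n⇒m⊔n≡n L≤m | m≤n⇒m⊔n≡n (≤-trans L≤m m≤m′) = ≤-refl
... | inj₂ m≤L rewrite m≥n⇒m⊔n≡m m≤L | ∸-distribʳ-⊔ L L m′ | n∸n≡0 L = ∸-monoʳ-≤ m′ m≤L

monotone-nonExpanding-contracts : ∀ (g : ℕ → ℕ) → (∀ {m m′} → m ≤ m′ → g m ≤ g m′) →
  NonExpanding g → ∀ a b → ∣ g a - g b ∣ ≤ ∣ a - b ∣
monotone-nonExpanding-contracts g mono nonExp a b with ≤-total a b
... | inj₁ a≤b rewrite m≤n⇒∣m-n∣≡n∸m (mono a≤b) | m≤n⇒∣m-n∣≡n∸m a≤b = nonExp a≤b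
... | inj₂ b≤a rewrite m≤n⇒∣n-m∣≡n∸m (mono b≤a) | m≤n⇒∣n-m∣≡n∸m b≤a = nonExp b≤a

clamp-contracts : ∀ L K a b → ∣ clamp L K a - clamp L K b ∣ ≤ ∣ a - b ∣
clamp-contracts L K = monotone-nonExpanding-contracts (clamp L K) (clamp-mono L K)
  (λ m≤m′ → ≤-trans (⊔-nonExpanding L (⊓-monoˡ-≤ K m≤m′)) (⊓-nonExpanding K m≤m′))

closer-from-below : ∀ {a b c} → c ≤ a → c ≤ b → ∣ a - c ∣ ≤ ∣ b - c ∣ → a ≤ b
closer-from-below {a} {b} {c} c≤a c≤b d =
  subst₂ _≤_ (m∸n+n≡m c≤a) (m∸n+n≡m c≤b)
    (+-monoˡ-≤ c (subst₂ _≤_ (m≤n⇒∣n-m∣≡n∸m c≤a) (m≤n⇒∣n-m∣≡n∸m c≤b) d))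

closer-from-above : ∀ {a b c} → a ≤ c → b ≤ c → ∣ a - c ∣ ≤ ∣ b - c ∣ → b ≤ a
closer-from-above a≤c b≤c d =
  ∸-cancelʳ-≤ b≤c (subst₂ _≤_ (m≤n⇒∣m-n∣≡n∸m a≤c) (m≤n⇒∣m-n∣≡n∸m b≤c) d)

bit : Bool → ℕ
bit true  = 1
bit false = 0

count : ℕ → (ℕ → Bool) → ℕ
count zero    P = 0
count (suc n) P = bit (P 0) + count n (P ∘ suc)

count-cong : ∀ n {P Q : ℕ → Bool} → (∀ i → P i ≡ Q i) → count n P ≡ count n Q
count-cong zero    P≗Q = refl
count-cong (suc n) P≗Q = cong₂ _+_ (cong bit (P≗Q 0)) (count-cong n (P≗Q ∘ suc))

∣tabulate∣≡count : ∀ n (g : Fin n → Bool) (P : ℕ → Bool) →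
  (∀ y → g y ≡ P (toℕ y)) → ∣ tabulate g ∣ ≡ count n P
∣tabulate∣≡count zero    g P g≗P = refl
∣tabulate∣≡count (suc n) g P g≗P =
  trans (∣∷∣ (g fzero) (tabulate (g ∘ fsuc)))
        (cong₂ _+_ (cong bit (g≗P fzero)) (∣tabulate∣≡count n (g ∘ fsuc) (P ∘ suc) (g≗P ∘ fsuc)))
  where
  ∣∷∣ : ∀ {k} b (v : Subset k) → ∣ b ∷ v ∣ ≡ bit b + ∣ v ∣
  ∣∷∣ true  v = refl
  ∣∷∣ false v = refl

between : ℕ → ℕ → ℕ → Bool
between L U i = does ((L ≤? i) ×-dec (i <? U))

between-suc : ∀ L U i → between L U (suc i) ≡ between (pred L) (pred U) i
between-suc L U i =
  does-⇔ (lower L ×-⇔ upper U) ((L ≤? suc i) ×-dec (suc i <? U)) ((pred L ≤? i) ×-dec (i <? pred U))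
  where
  lower : ∀ L → (L ≤ suc i) ⇔ (pred L ≤ i)
  lower zero    = mk⇔ (λ _ → z≤n) (λ _ → z≤n)
  lower (suc l) = mk⇔ ≤-pred s≤s
  upper : ∀ U → (suc i < U) ⇔ (i < pred U)
  upper zero    = mk⇔ (λ ()) (λ ())
  upper (suc u) = mk⇔ ≤-pred s≤s

count-between : ∀ n L U → count n (between L U) ≡ (n ⊓ U) ∸ L
count-between zero    L U = sym (0∸n≡0 L)
count-between (suc n) L U = begin
  bit (between L U 0) + count n (between L U ∘ suc)
    ≡⟨ cong (bit (between L U 0) +_) (count-cong n (between-suc L U)) ⟩
  bit (between L U 0) + count n (between (pred L) (pred U))
    ≡⟨ cong (bit (between L U 0) +_) (count-between n (pred L) (pred U)) ⟩
  bit (between L U 0) + ((n ⊓ pred U) ∸ pred L)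
    ≡⟨ first-point L U ⟩
  (suc n ⊓ U) ∸ L ∎
  where
  open ≡-Reasoning
  first-point : ∀ L U → bit (between L U 0) + ((n ⊓ pred U) ∸ pred L) ≡ (suc n ⊓ U) ∸ L
  first-point zero    zero    = ⊓-zeroʳ n
  first-point zero    (suc u) = refl
  first-point (suc l) zero    = trans (cong (_∸ l) (⊓-zeroʳ n)) (0∸n≡0 l)
  first-point (suc l) (suc u) = refl

idempotent-image⇔fixed : ∀ {n} (α : Transformation n) → Idempotent α →
  ∀ y → (∃ λ x → α x ≡ y) ⇔ (α y ≡ y)
idempotent-image⇔fixed α idem y = mk⇔ (λ { (x , refl) → idem x }) (λ fixed → y , fixed)

idempotent-h≡fix : ∀ {n} (α : Transformation n) → Idempotent α → h α ≡ fix α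
idempotent-h≡fix α idem = cong ∣_∣ (tabulate-cong λ y →
  does-⇔ (idempotent-image⇔fixed α idem y) (any? (λ x → α x ≟F y)) (α y ≟F y))

values : ∀ {n} → Transformation n → List ℕ
values {n} α = map (λ x → suc (toℕ (α x))) (allFin n)

w⁺-upper : ∀ {n} (α : Transformation n) x → suc (toℕ (α x)) ≤ w⁺ α
w⁺-upper α x = All.lookup (map⁻ values≤w⁺) (∈-allFin x)
  where
  values≤w⁺ : All.All (_≤ w⁺ α) (values α)
  values≤w⁺ = foldr-forcesᵇ {P = _≤ w⁺ α}
    (λ a b ⊔≤ → m⊔n≤o⇒m≤o a b ⊔≤ , m⊔n≤o⇒n≤o a b ⊔≤) 0 (values α) ≤-refl

w⁺-least : ∀ {n} (α : Transformation n) {b} → (∀ x → suc (toℕ (α x)) ≤ b) → w⁺ α ≤ b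
w⁺-least α {b} bound =
  foldr-preservesᵇ {P = _≤ b} ⊔-lub {xs = values α} z≤n (map⁺ (All.tabulate (λ {x} _ → bound x)))

w⁺-attained : ∀ {m} (α : Transformation (suc m)) → ∃ λ x → w⁺ α ≡ suc (toℕ (α x))
w⁺-attained α with foldr-selective ⊔-sel 0 (values α)
... | inj₁ w⁺≡0 = contradiction (subst (1 ≤_) w⁺≡0 (≤-trans (s≤s z≤n) (w⁺-upper α fzero))) λ ()
... | inj₂ w⁺∈ with ∈-map⁻ _ w⁺∈
...   | x , _ , eq = x , eq

fixed-point-below : ∀ {n} {γ : Transformation n} → Contraction γ → ∀ {y z} → γ y ≡ y →
  toℕ y ≤ toℕ z → toℕ y ≤ toℕ (γ z) → toℕ (γ z) ≤ toℕ z
fixed-point-below {γ = γ} contr {y} {z} fixed y≤z y≤γz = closer-from-below y≤γz y≤z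
  (subst (λ t → ∣ toℕ (γ z) - toℕ t ∣ ≤ ∣ toℕ z - toℕ y ∣) fixed (contr z y))

fixed-point-above : ∀ {n} {γ : Transformation n} → Contraction γ → ∀ {y z} → γ y ≡ y →
  toℕ z ≤ toℕ y → toℕ (γ z) ≤ toℕ y → toℕ z ≤ toℕ (γ z)
fixed-point-above {γ = γ} contr {y} {z} fixed z≤y γz≤y = closer-from-above γz≤y z≤y
  (subst (λ t → ∣ toℕ (γ z) - toℕ t ∣ ≤ ∣ toℕ z - toℕ y ∣) fixed (contr z y))

Clamped : ∀ {n} → Transformation n → ℕ → ℕ → Set
Clamped {n} γ L K = ∀ (x : Fin n) → toℕ (γ x) ≡ clamp L K (toℕ x)

clampT : ∀ {n} L K → L ≤ K → K < n → Transformation n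
clampT L K L≤K K<n x = fromℕ< (≤-<-trans (proj₂ (clamp-range L K L≤K (toℕ x))) K<n)

clampT-clamped : ∀ {n} L K (L≤K : L ≤ K) (K<n : K < n) → Clamped (clampT L K L≤K K<n) L K
clampT-clamped L K L≤K K<n x = toℕ-fromℕ< _

clamped-unique : ∀ {n} {γ δ : Transformation n} {L K} →
  Clamped γ L K → Clamped δ L K → ∀ x → γ x ≡ δ x
clamped-unique γ-clamped δ-clamped x = toℕ-injective (trans (γ-clamped x) (sym (δ-clamped x)))

clamped-EOCT : ∀ {n} {γ : Transformation n} {L K} → L ≤ K → Clamped γ L K → IsEOCT γ
clamped-EOCT {γ = γ} {L} {K} L≤K c = idem , mono , contr
  where
  open ≡-Reasoning
  idem : Idempotent γ
  idem x = toℕ-injective (begin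
    toℕ (γ (γ x))                 ≡⟨ c (γ x) ⟩
    clamp L K (toℕ (γ x))         ≡⟨ cong (clamp L K) (c x) ⟩
    clamp L K (clamp L K (toℕ x)) ≡⟨ clamp-idem L K L≤K (toℕ x) ⟩
    clamp L K (toℕ x)             ≡⟨ sym (c x) ⟩
    toℕ (γ x)                     ∎)
  mono : OrderPreserving γ
  mono x y x≤y rewrite c x | c y = clamp-mono L K x≤y
  contr : Contraction γ
  contr x y rewrite c x | c y = clamp-contracts L K (toℕ x) (toℕ y)

clamped-fixed⇔ : ∀ {n} {γ : Transformation n} {L K} → L ≤ K → Clamped γ L K →
  ∀ y → (γ y ≡ y) ⇔ (L ≤ toℕ y × toℕ y < suc K)
clamped-fixed⇔ {γ = γ} {L} {K} L≤K c y = mk⇔ in-range (λ (L≤y , y<sK) →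
  toℕ-injective (trans (c y) (clamp-fixes L K L≤y (≤-pred y<sK))))
  where
  in-range : γ y ≡ y → L ≤ toℕ y × toℕ y < suc K
  in-range fixed with subst (λ t → L ≤ t × t ≤ K) (trans (sym (c y)) (cong toℕ fixed))
                            (clamp-range L K L≤K (toℕ y))
  ... | L≤y , y≤K = L≤y , s≤s y≤K

clamped-fix : ∀ {n} {γ : Transformation n} {L K} → L ≤ K → K < n → Clamped γ L K →
  fix γ ≡ suc K ∸ L
clamped-fix {n} {γ} {L} {K} L≤K K<n c = begin
  fix γ                       ≡⟨ ∣tabulate∣≡count n _ (between L (suc K)) fixed≡between ⟩
  count n (between L (suc K)) ≡⟨ count-between n L (suc K) ⟩
  (n ⊓ suc K) ∸ L             ≡⟨ cong (_∸ L) (m≥n⇒m⊓n≡n K<n) ⟩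
  suc K ∸ L                   ∎
  where
  open ≡-Reasoning
  fixed≡between : ∀ y → does (γ y ≟F y) ≡ between L (suc K) (toℕ y)
  fixed≡between y = does-⇔ (clamped-fixed⇔ L≤K c y) (γ y ≟F y) ((L ≤? toℕ y) ×-dec (toℕ y <? suc K))

clamped-w⁺ : ∀ {n} {γ : Transformation n} {L K} → L ≤ K → K < n → Clamped γ L K →
  w⁺ γ ≡ suc K
clamped-w⁺ {γ = γ} {L} {K} L≤K K<n c =
  ≤-antisym (w⁺-least γ bounded) (subst (_≤ w⁺ γ) (cong suc γxK≡K) (w⁺-upper γ xK))
  where
  bounded : ∀ x → suc (toℕ (γ x)) ≤ suc K
  bounded x = s≤s (subst (_≤ K) (sym (c x)) (proj₂ (clamp-range L K L≤K (toℕ x))))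
  xK : Fin _
  xK = fromℕ< K<n
  γxK≡K : toℕ (γ xK) ≡ K
  γxK≡K = trans (c xK) (trans (cong (clamp L K) (toℕ-fromℕ< K<n)) (clamp-above L K L≤K ≤-refl))

EOCT-clamped : ∀ {m} (β : Transformation (suc m)) {K} → IsEOCT β → w⁺ β ≡ suc K →
  toℕ (β fzero) ≤ K × Clamped β (toℕ (β fzero)) K
EOCT-clamped β {K} (idem , mono , contr) w⁺≡ = upper fzero , shape
  where
  L : ℕ
  L = toℕ (β fzero)
  upper : ∀ z → toℕ (β z) ≤ K
  upper z = ≤-pred (subst (suc (toℕ (β z)) ≤_) w⁺≡ (w⁺-upper β z))
  lower : ∀ z → L ≤ toℕ (β z)
  lower z = mono fzero z z≤n
  -- β fzero and β xK are the least and greatest points of the image; both are fixed.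
  xK : Fin _
  xK = proj₁ (w⁺-attained β)
  βxK≡K : toℕ (β xK) ≡ K
  βxK≡K = suc-injective (trans (sym (proj₂ (w⁺-attained β))) w⁺≡)
  ββxK≡K : toℕ (β (β xK)) ≡ K
  ββxK≡K = trans (cong toℕ (idem xK)) βxK≡K
  shape : Clamped β L K
  shape z with toℕ z ≤? L
  ... | yes z≤L = trans (≤-antisym βz≤L (lower z)) (sym (clamp-below L K z≤L))
    where
    βz≤L : toℕ (β z) ≤ L
    βz≤L = subst (toℕ (β z) ≤_) (cong toℕ (idem fzero)) (mono z (β fzero) z≤L)
  ... | no z≰L with K ≤? toℕ z
  ...   | yes K≤z = trans (≤-antisym (upper z) K≤βz) (sym (clamp-above L K (upper fzero) K≤z))
    where
    K≤βz : K ≤ toℕ (β z)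
    K≤βz = subst (_≤ toℕ (β z)) ββxK≡K (mono (β xK) z (subst (_≤ toℕ z) (sym βxK≡K) K≤z))
  ...   | no K≰z = trans (≤-antisym βz≤z z≤βz) (sym (clamp-fixes L K L≤z z≤K))
    where
    L≤z : L ≤ toℕ z
    L≤z = <⇒≤ (≰⇒> z≰L)
    z≤K : toℕ z ≤ K
    z≤K = <⇒≤ (≰⇒> K≰z)
    βz≤z : toℕ (β z) ≤ toℕ z
    βz≤z = fixed-point-below contr (idem fzero) L≤z (lower z)
    z≤βz : toℕ z ≤ toℕ (β z)
    z≤βz = fixed-point-above contr (idem xK)
             (subst (toℕ z ≤_) (sym βxK≡K) z≤K) (subst (toℕ (β z) ≤_) (sym βxK≡K) (upper z))

exactlyOne-by-fix : ∀ {m} (s : Transformation (suc m) → ℕ) →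
  (∀ α → Idempotent α → s α ≡ fix α) → ∀ {p K} → 1 ≤ p → p ≤ suc K → K < suc m →
  ExactlyOne {suc m} (λ α → IsEOCT α × s α ≡ p × w⁺ α ≡ suc K)
exactlyOne-by-fix s s≡fix {p} {K} 1≤p p≤k K<n =
  α , (clamped-EOCT L₀≤K α-clamped , sα≡p , clamped-w⁺ L₀≤K K<n α-clamped) , unique
  where
  L₀ : ℕ
  L₀ = suc K ∸ p
  L₀≤K : L₀ ≤ K
  L₀≤K = ∸-monoʳ-≤ (suc K) 1≤p
  α : Transformation _
  α = clampT L₀ K L₀≤K K<n
  α-clamped : Clamped α L₀ K
  α-clamped = clampT-clamped L₀ K L₀≤K K<n
  s-clamped : ∀ γ {L} → L ≤ K → Clamped γ L K → s γ ≡ suc K ∸ L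
  s-clamped γ L≤K c = trans (s≡fix γ (proj₁ (clamped-EOCT L≤K c))) (clamped-fix L≤K K<n c)
  sα≡p : s α ≡ p
  sα≡p = trans (s-clamped α L₀≤K α-clamped) (m∸[m∸n]≡n p≤k)
  -- s β = K + 1 − L determines the lower end L of β's interval.
  unique : ∀ β → IsEOCT β × s β ≡ p × w⁺ β ≡ suc K → ∀ x → β x ≡ α x
  unique β (E , sβ≡p , w⁺≡) with EOCT-clamped β E w⁺≡
  ... | L≤K , β-clamped = clamped-unique (subst (λ L → Clamped β L K) L≡L₀ β-clamped) α-clamped
    where
    L≡L₀ : toℕ (β fzero) ≡ L₀
    L≡L₀ = trans (sym (m∸[m∸n]≡n (m≤n⇒m≤1+n L≤K)))
                 (cong (suc K ∸_) (trans (sym (s-clamped β L≤K β-clamped)) sβ≡p))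

corollary2p11 : (n p k : ℕ) → 1 ≤ n → 1 ≤ p → p ≤ k → k ≤ n →
    ExactlyOne {n} (λ α → IsEOCT α × h α ≡ p × w⁺ α ≡ k)
    × ExactlyOne {n} (λ α → IsEOCT α × fix α ≡ p × w⁺ α ≡ k)
corollary2p11 zero    p k       ()  _   _   _
corollary2p11 (suc m) p zero    _   1≤p p≤0 _   = contradiction (≤-trans 1≤p p≤0) λ ()
corollary2p11 (suc m) p (suc K) _   1≤p p≤k k≤n =
  exactlyOne-by-fix h idempotent-h≡fix 1≤p p≤k k≤n ,
  exactlyOne-by-fix fix (λ _ _ → refl) 1≤p p≤k k≤n
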